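{- Let $T$ be a tree with vertex set $\{1,\ldots,n\}$ whose edges carry nonzero real weights. Let $D$ be its weighted distance matrix, $\Delta$ its squared distance matrix, $\tau$ the vector with entries $\tau_i=2-\delta_i$ ($\delta_i$ the degree of vertex $i$), and $\hat\delta$ the vector of weighted degrees. Then $\Delta\tau=D\hat\delta$.
   Context: For vertices $i\neq j$, $d(i,j)$ is the sum of the weights of the edges on the unique $ij$-path, and $d(i,i)=0$. $D$ is the $n\times n$ matrix with $(i,j)$-entry $d(i,j)$ and $\Delta$ is the $n\times n$ matrix with $(i,j)$-entry $d(i,j)^2$. $\delta_i$ is the (unweighted) degree of vertex $i$, $\tau=(\tau_1,\ldots,\tau_n)'$ with $\tau_i=2-\delta_i$. The weighted degree of vertex $i$ is $\hat\delta_i=\sum_{j\sim i} w(\{i,j\})$, the sum of the weights of the edges incident to $i$, and $\hat\delta=(\hat\delta_1,\ldots,\hat\delta_n)'$. -}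

module Defs where

open import Level using (Level; _⊔_)
open import Data.Nat using (ℕ)
open import Data.Bool using (Bool; true; false; if_then_else_)
open import Data.Fin using (Fin)
open import Data.List using (List; []; _∷_)
open import Data.List.Relation.Unary.Unique.Propositional using (Unique)
open import Data.Product using (Σ; _×_)
open import Relation.Binary.PropositionalEquality using (_≡_)
open import Relation.Nullary using (¬_)
open import Algebra.Bundles using (CommutativeRing)
import Algebra.Properties.Monoid.Sum as MonoidSum

record SimpleGraph (n : ℕ) : Set where
  field
    adj   : Fin n → Fin n → Bool
    sym   : ∀ i j → adj i j ≡ adj j i
    loopless : ∀ i → adj i i ≡ false

module _ {n : ℕ} (G : SimpleGraph n) where
  open SimpleGraph G

  data Walk : Fin n → Fin n → Set where
    stop : ∀ i → Walk i i
    step : ∀ i {j k} → adj i j ≡ true → Walk j k → Walk i k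

  vertices : ∀ {i j} → Walk i j → List (Fin n)
  vertices (stop i)       = i ∷ []
  vertices (step i _ p)   = i ∷ vertices p

  Path : Fin n → Fin n → Set
  Path i j = Σ (Walk i j) (λ p → Unique (vertices p))

  record IsTree : Set where
    field
      path   : ∀ i j → Path i j
      unique : ∀ i j (p q : Path i j) →
               vertices (Σ.proj₁ p) ≡ vertices (Σ.proj₁ q)

module WeightedTree {c ℓ : Level} (R : CommutativeRing c ℓ) where
  open CommutativeRing R hiding (_≈_)
  open CommutativeRing R public using (_≈_)
  open MonoidSum +-monoid using (sum)

  2# : Carrier
  2# = 1# + 1#

  -- weight function on edges: symmetric; w i j is the weight of edge {i,j}
  -- (values on non-edges are irrelevant)
  record EdgeWeights {n : ℕ} (G : SimpleGraph n) : Set (c ⊔ ℓ) where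
    open SimpleGraph G
    field
      w       : Fin n → Fin n → Carrier
      w-sym   : ∀ i j → w i j ≡ w j i
      nonzero : ∀ i j → adj i j ≡ true → ¬ (w i j ≈ 0#)

  module _ {n : ℕ} (G : SimpleGraph n) (W : EdgeWeights G) where
    open SimpleGraph G
    open EdgeWeights W

    walkWeight : ∀ {i j} → Walk G i j → Carrier
    walkWeight (stop i)              = 0#
    walkWeight (step i {j} _ p)      = w i j + walkWeight p

    dist : IsTree G → Fin n → Fin n → Carrier
    dist T i j = walkWeight (Σ.proj₁ (IsTree.path T i j))

    deg : Fin n → Carrier
    deg i = sum (λ j → if adj i j then 1# else 0#)

    τ : Fin n → Carrier
    τ i = 2# - deg i

    wdeg : Fin n → Carrier
    wdeg i = sum (λ j → if adj i j then w i j else 0#)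

    Dmul : IsTree G → (Fin n → Carrier) → Fin n → Carrier
    Dmul T v i = sum (λ j → dist T i j * v j)

    Δmul : IsTree G → (Fin n → Carrier) → Fin n → Carrier
    Δmul T v i = sum (λ j → (dist T i j * dist T i j) * v j)

module Submission where

-- Root the tree at i and write d j for d(i,j).  As (Δτ)ᵢ = ∑ⱼ d j² (2 − δⱼ) and (Dδ̂)ᵢ = ∑ⱼ d j δ̂ⱼ,
-- it suffices that ∑ⱼ (d j² δⱼ + d j δ̂ⱼ) = ∑ⱼ 2 d j².  The left side is a sum over ordered
-- adjacent pairs (j,k) of d j² + d j w(j,k).  Pair the two orientations of each edge; if k is the
-- parent of j then d j = d k + w(j,k), so the edge contributes (d j² + d j w) + (d k² + d k w) = 2 d j².
-- Every vertex but the root has exactly one parent, and d i = 0.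

open import Defs
open import Level using (Level)
open import Data.Nat using (ℕ; suc)
open import Data.Fin using (Fin; punchIn) renaming (_≟_ to _≟ᶠ_)
open import Data.Fin.Properties using (punchInᵢ≢i)
open import Data.Bool using (Bool; true; false; _∧_; if_then_else_)
open import Data.List using (List; []; _∷_; _++_; _∷ʳ_; drop)
open import Data.List.Properties
  using (≡-dec; ++-assoc; ∷ʳ-injective; ++-identityʳ-unique)
open import Data.List.Relation.Unary.Any using (here; there)
open import Data.List.Relation.Unary.All using (lookup; []; _∷_)
import Data.List.Relation.Unary.All.Properties as All
open import Data.List.Relation.Unary.AllPairs using ([]; _∷_)
open import Data.List.Relation.Unary.Unique.Propositional using (Unique)
import Data.List.Relation.Unary.Unique.Propositional.Properties as Unique
open import Data.List.Relation.Binary.Disjoint.Propositional using (Disjoint)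
open import Data.List.Membership.Propositional using (_∈_; _∉_)
open import Data.List.Membership.Propositional.Properties using (∈-++⁺ʳ)
import Data.List.Membership.DecPropositional as DecMembership
open import Data.Product using (Σ; ∃; _×_; _,_; proj₁; proj₂)
open import Data.Sum using (_⊎_; inj₁; inj₂)
open import Data.Empty using (⊥; ⊥-elim)
open import Relation.Nullary using (yes; no; Dec; does)
open import Relation.Nullary.Decidable using (dec-true)
open import Relation.Binary.PropositionalEquality
  using (_≡_; _≢_; refl; sym; trans; cong; cong₂; subst)
open import Algebra.Bundles using (CommutativeRing)
import Algebra.Properties.Semiring.Sum as SemiringSum
import Algebra.Properties.Ring as RingProperties
import Algebra.Solver.Ring.NaturalCoefficients.Default as NatSolver
import Relation.Binary.Reasoning.Setoid as SetoidReasoning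

module _ {A : Set} where

  Unique-++⁻ˡ : ∀ (xs : List A) {ys} → Unique (xs ++ ys) → Unique xs
  Unique-++⁻ˡ []       _        = []
  Unique-++⁻ˡ (x ∷ xs) (px ∷ u) = All.++⁻ˡ xs px ∷ Unique-++⁻ˡ xs u

  Unique-++⁻ʳ : ∀ (xs : List A) {ys} → Unique (xs ++ ys) → Unique ys
  Unique-++⁻ʳ []       u       = u
  Unique-++⁻ʳ (x ∷ xs) (_ ∷ u) = Unique-++⁻ʳ xs u

  Unique-++⇒Disjoint : ∀ (xs : List A) {ys} → Unique (xs ++ ys) → Disjoint xs ys
  Unique-++⇒Disjoint (x ∷ xs) (px ∷ _) (here refl , y∈ys) = lookup (All.++⁻ʳ xs px) y∈ys refl
  Unique-++⇒Disjoint (x ∷ xs) (_ ∷ u)  (there v∈xs , v∈ys) = Unique-++⇒Disjoint xs u (v∈xs , v∈ys)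

  Unique-∷ʳ⁺ : ∀ {xs : List A} {x} → Unique xs → x ∉ xs → Unique (xs ∷ʳ x)
  Unique-∷ʳ⁺ u x∉xs = Unique.++⁺ u ([] ∷ []) λ { (v∈xs , here refl) → x∉xs v∈xs }

module Walks {n : ℕ} (G : SimpleGraph n) where
  open SimpleGraph G using (adj; loopless) renaming (sym to adj-sym)

  adj⇒≢ : ∀ {j k} → adj j k ≡ true → j ≢ k
  adj⇒≢ {j} e refl with trans (sym e) (loopless j)
  ... | ()

  vertices-∷ʳ-end : ∀ {a b} (p : Walk G a b) → ∃ λ ys → vertices G p ≡ ys ∷ʳ b
  vertices-∷ʳ-end (stop a)     = [] , refl
  vertices-∷ʳ-end (step a e p) with vertices-∷ʳ-end p
  ... | ys , eq = a ∷ ys , cong (a ∷_) eq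

  end∈vertices : ∀ {a b} (p : Walk G a b) → b ∈ vertices G p
  end∈vertices p with vertices-∷ʳ-end p
  ... | ys , eq = subst (_ ∈_) (sym eq) (∈-++⁺ʳ ys (here refl))

  splitAt : ∀ {a b x} (p : Walk G a b) → x ∈ vertices G p →
            Σ (Walk G a x) λ q → Σ (Walk G x b) λ r →
            vertices G p ≡ vertices G q ++ drop 1 (vertices G r)
  splitAt (stop a)     (here refl) = stop a , stop a , refl
  splitAt (step a e p) (here refl) = stop a , step a e p , refl
  splitAt (step a e p) (there x∈p) with splitAt p x∈p
  ... | q , r , eq = step a e q , r , cong (a ∷_) eq

  _▷_ : ∀ {a b c} (p : Walk G a b) → adj b c ≡ true →
        Σ (Walk G a c) λ q → vertices G q ≡ vertices G p ∷ʳ c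
  stop a     ▷ e = step a e (stop _) , refl
  step a e p ▷ e′ with p ▷ e′
  ... | q , eq = step a e q , cong (a ∷_) eq

  unsnoc : ∀ {a j b} → adj a j ≡ true → (p : Walk G j b) →
           Σ (Fin n) λ k → Σ (Walk G a k) λ q →
           adj k b ≡ true × a ∷ vertices G p ≡ vertices G q ∷ʳ b
  unsnoc {a} e (stop j)      = a , stop a , e , refl
  unsnoc {a} e (step j e′ p) with unsnoc e′ p
  ... | k , q , e″ , eq = k , step a e q , e″ , cong (a ∷_) eq

  module Tree (T : IsTree G) where

    path-vertices-adjacent : ∀ {k j} (q : Walk G k j) → Unique (vertices G q) →
                             adj k j ≡ true → vertices G q ≡ k ∷ j ∷ []
    path-vertices-adjacent {k} {j} q u e = IsTree.unique T k j (q , u) (edge , edge-unique)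
      where
      edge : Walk G k j
      edge = step k e (stop j)
      edge-unique : Unique (vertices G edge)
      edge-unique = ((adj⇒≢ e) ∷ []) ∷ [] ∷ []

    module Rooted (r : Fin n) where
      open DecMembership (_≟ᶠ_ {n}) using (_∈?_)

      path : ∀ j → Walk G r j
      path j = proj₁ (IsTree.path T r j)

      pathVertices : Fin n → List (Fin n)
      pathVertices j = vertices G (path j)

      pathVertices-unique : ∀ j → Unique (pathVertices j)
      pathVertices-unique j = proj₂ (IsTree.path T r j)

      path-vertices : ∀ {j} (q : Walk G r j) → Unique (vertices G q) → vertices G q ≡ pathVertices j
      path-vertices {j} q u = IsTree.unique T r j (q , u) (IsTree.path T r j)

      pathVertices-root : pathVertices r ≡ r ∷ []
      pathVertices-root = sym (path-vertices (stop r) ([] ∷ []))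

      Parent : Fin n → Fin n → Set
      Parent j k = pathVertices j ≡ pathVertices k ∷ʳ j

      Parent? : ∀ j k → Dec (Parent j k)
      Parent? j k = ≡-dec _≟ᶠ_ (pathVertices j) (pathVertices k ∷ʳ j)

      on-path⇒parent : ∀ {j k} → adj j k ≡ true → k ∈ pathVertices j → Parent j k
      on-path⇒parent {j} {k} e k∈path with splitAt (path j) k∈path
      ... | q , stop _ , _ = ⊥-elim (adj⇒≢ e refl)
      ... | q , step _ e′ s , eq = begin
        pathVertices j                  ≡⟨ eq ⟩
        vertices G q ++ vertices G s    ≡⟨ cong₂ _++_ q-path s-edge ⟩
        pathVertices k ∷ʳ j             ∎
        where
        open Relation.Binary.PropositionalEquality.≡-Reasoning
        u : Unique (vertices G q ++ vertices G s)
        u = subst Unique eq (pathVertices-unique j)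
        q-path : vertices G q ≡ pathVertices k
        q-path = path-vertices q (Unique-++⁻ˡ (vertices G q) u)
        k∉s : k ∉ vertices G s
        k∉s k∈s = Unique-++⇒Disjoint (vertices G q) u (end∈vertices q , k∈s)
        s-edge : vertices G s ≡ j ∷ []
        s-edge = cong (drop 1)
          (path-vertices-adjacent (step k e′ s)
            (All.¬Any⇒All¬ (vertices G s) k∉s ∷ Unique-++⁻ʳ (vertices G q) u)
            (trans (adj-sym k j) e))

      off-path⇒child : ∀ {j k} → adj j k ≡ true → k ∉ pathVertices j → Parent k j
      off-path⇒child {j} {k} e k∉path with path j ▷ e
      ... | q , eq = trans (sym (path-vertices q q-unique)) eq
        where
        q-unique : Unique (vertices G q)
        q-unique = subst Unique (sym eq) (Unique-∷ʳ⁺ (pathVertices-unique j) k∉path)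

      parent⊎child : ∀ {j k} → adj j k ≡ true → Parent j k ⊎ Parent k j
      parent⊎child {j} {k} e with k ∈? pathVertices j
      ... | yes k∈path = inj₁ (on-path⇒parent e k∈path)
      ... | no  k∉path = inj₂ (off-path⇒child e k∉path)

      ¬parent×child : ∀ {j k} → Parent j k → Parent k j → ⊥
      ¬parent×child {j} {k} j→k k→j = nonempty (++-identityʳ-unique (pathVertices j) cycle)
        where
        nonempty : k ∷ j ∷ [] ≢ []
        nonempty ()
        cycle : pathVertices j ≡ pathVertices j ++ k ∷ j ∷ []
        cycle = trans j→k (trans (cong (_∷ʳ j) k→j) (++-assoc (pathVertices j) (k ∷ []) (j ∷ [])))

      parent-unique : ∀ {j k k′} → Parent j k → Parent j k′ → k ≡ k′
      parent-unique {j} {k} {k′} j→k j→k′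
        with vertices-∷ʳ-end (path k) | vertices-∷ʳ-end (path k′)
      ... | ys , eq | ys′ , eq′ = proj₂ (∷ʳ-injective ys ys′ (trans (sym eq) (trans same-path eq′)))
        where
        same-path : pathVertices k ≡ pathVertices k′
        same-path = proj₁ (∷ʳ-injective (pathVertices k) (pathVertices k′) (trans (sym j→k) j→k′))

      parent-exists : ∀ {j} → j ≢ r → ∃ λ k → adj j k ≡ true × Parent j k
      parent-exists {j} j≢r = last-edge j≢r (path j) (pathVertices-unique j)
        where
        last-edge : ∀ {x} → x ≢ r → (p : Walk G r x) → Unique (vertices G p) →
                    ∃ λ k → adj x k ≡ true × Parent x k
        last-edge x≢r (stop _) _ = ⊥-elim (x≢r refl)
        last-edge {x} _ (step _ e p) u with unsnoc e p
        ... | k , q , e′ , eq = k , trans (adj-sym x k) e′ , (begin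
          pathVertices x        ≡⟨ sym (path-vertices (step r e p) u) ⟩
          r ∷ vertices G p      ≡⟨ eq ⟩
          vertices G q ∷ʳ x     ≡⟨ cong (_∷ʳ x) (path-vertices q (Unique-++⁻ˡ (vertices G q) (subst Unique eq u))) ⟩
          pathVertices k ∷ʳ x   ∎)
          where open Relation.Binary.PropositionalEquality.≡-Reasoning

does⇒ : ∀ {P : Set} (p? : Dec P) → does p? ≡ true → P
does⇒ (yes p) _ = p

module IndicatorSums {c ℓ : Level} (R : CommutativeRing c ℓ) where
  open CommutativeRing R renaming (refl to ≈-refl; sym to ≈-sym; trans to ≈-trans)
  open WeightedTree R using (2#)
  open SemiringSum semiring
    using (sum; sum-cong-≋; sum-replicate-zero; sum-remove; ∑-distrib-+; ∑-comm)
  open RingProperties ring using (+-cancelʳ)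
  open NatSolver commutativeSemiring using (solve; _:=_; _:+_; _:*_)
  open SetoidReasoning setoid

  infix 8 [_]·_
  [_]·_ : Bool → Carrier → Carrier
  [ b ]· x = if b then x else 0#

  []·-true : ∀ {b} x → b ≡ true → [ b ]· x ≈ x
  []·-true x refl = ≈-refl

  []·-≢true : ∀ b {x} → b ≢ true → [ b ]· x ≈ 0#
  []·-≢true false _      = ≈-refl
  []·-≢true true  b≢true = ⊥-elim (b≢true refl)

  []·-zero : ∀ b {x} → x ≈ 0# → [ b ]· x ≈ 0#
  []·-zero true  x≈0 = x≈0
  []·-zero false _   = ≈-refl

  []·-+ : ∀ b x y → [ b ]· x + [ b ]· y ≈ [ b ]· (x + y)
  []·-+ true  x y = ≈-refl
  []·-+ false x y = +-identityˡ 0#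

  []·-split : ∀ a b c {x} → (a ≡ true → b ≡ true ⊎ c ≡ true) → (b ≡ true → c ≡ true → ⊥) →
              [ a ]· x ≈ [ a ∧ b ]· x + [ a ∧ c ]· x
  []·-split false _     _     _     _        = ≈-sym (+-identityˡ 0#)
  []·-split true  true  true  _     not-both = ⊥-elim (not-both refl refl)
  []·-split true  true  false _     _        = ≈-sym (+-identityʳ _)
  []·-split true  false true  _     _        = ≈-sym (+-identityˡ _)
  []·-split true  false false one-of _ with one-of refl
  ... | inj₁ ()
  ... | inj₂ ()

  sum-zero : ∀ {m} (f : Fin m → Carrier) → (∀ k → f k ≈ 0#) → sum f ≈ 0#
  sum-zero {m} f f≈0 = ≈-trans (sum-cong-≋ f≈0) (sum-replicate-zero m)

  sum-[]·-unique : ∀ {m} (p : Fin m → Bool) {k} x → p k ≡ true → (∀ k′ → p k′ ≡ true → k′ ≡ k) →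
                   sum (λ k′ → [ p k′ ]· x) ≈ x
  sum-[]·-unique {suc m} p {k} x pk only-k = begin
    sum (λ k′ → [ p k′ ]· x)                           ≈⟨ sum-remove {i = k} (λ k′ → [ p k′ ]· x) ⟩
    [ p k ]· x + sum (λ k′ → [ p (punchIn k k′) ]· x)  ≈⟨ +-cong ([]·-true x pk) (sum-zero _ off-k) ⟩
    x + 0#                                             ≈⟨ +-identityʳ x ⟩
    x                                                  ∎
    where
    off-k : ∀ k′ → [ p (punchIn k k′) ]· x ≈ 0#
    off-k k′ = []·-≢true (p (punchIn k k′)) (λ e → punchInᵢ≢i k k′ (only-k _ e))

  ∑∑-orient : ∀ {m} (e o : Fin m → Fin m → Bool) →
              (∀ j k x → [ e j k ]· x ≈ [ o j k ]· x + [ o k j ]· x) →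
              (f : Fin m → Fin m → Carrier) →
              sum (λ j → sum (λ k → [ e j k ]· f j k)) ≈
              sum (λ j → sum (λ k → [ o j k ]· (f j k + f k j)))
  ∑∑-orient {m} e o split f = begin
    ∑∑ (λ j k → [ e j k ]· f j k)
      ≈⟨ sum-cong-≋ (λ j → sum-cong-≋ (λ k → split j k (f j k))) ⟩
    ∑∑ (λ j k → [ o j k ]· f j k + [ o k j ]· f j k)
      ≈⟨ ∑∑-distrib-+ (λ j k → [ o j k ]· f j k) (λ j k → [ o k j ]· f j k) ⟩
    ∑∑ (λ j k → [ o j k ]· f j k) + ∑∑ (λ j k → [ o k j ]· f j k)
      ≈⟨ +-congˡ (∑-comm (λ j k → [ o k j ]· f j k)) ⟩
    ∑∑ (λ j k → [ o j k ]· f j k) + ∑∑ (λ j k → [ o j k ]· f k j)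
      ≈⟨ ∑∑-distrib-+ (λ j k → [ o j k ]· f j k) (λ j k → [ o j k ]· f k j) ⟨
    ∑∑ (λ j k → [ o j k ]· f j k + [ o j k ]· f k j)
      ≈⟨ sum-cong-≋ (λ j → sum-cong-≋ (λ k → []·-+ (o j k) (f j k) (f k j))) ⟩
    ∑∑ (λ j k → [ o j k ]· (f j k + f k j))
      ∎
    where
    ∑∑ : (Fin m → Fin m → Carrier) → Carrier
    ∑∑ g = sum (λ j → sum (λ k → g j k))
    ∑∑-distrib-+ : ∀ g h → ∑∑ (λ j k → g j k + h j k) ≈ ∑∑ g + ∑∑ h
    ∑∑-distrib-+ g h = ≈-trans (sum-cong-≋ (λ j → ∑-distrib-+ (g j) (h j))) (∑-distrib-+ (λ j → sum (g j)) (λ j → sum (h j)))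

  square-identity : ∀ {a b c} → a ≈ b + c → (a * a + a * c) + (b * b + b * c) ≈ a * a + a * a
  square-identity {a} {b} {c} a≈b+c = begin
    (a * a + a * c) + (b * b + b * c)
      ≈⟨ +-congʳ (+-cong (*-cong a≈b+c a≈b+c) (*-congʳ a≈b+c)) ⟩
    ((b + c) * (b + c) + (b + c) * c) + (b * b + b * c)
      ≈⟨ solve 2 (λ x y → ((x :+ y) :* (x :+ y) :+ (x :+ y) :* y) :+ (x :* x :+ x :* y)
                        := (x :+ y) :* (x :+ y) :+ (x :+ y) :* (x :+ y)) ≈-refl b c ⟩
    (b + c) * (b + c) + (b + c) * (b + c)
      ≈⟨ +-cong (*-cong a≈b+c a≈b+c) (*-cong a≈b+c a≈b+c) ⟨
    a * a + a * a
      ∎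

  ∑-*-2-minus : ∀ {m} (s δ t : Fin m → Carrier) →
                sum (λ j → s j * δ j + t j) ≈ sum (λ j → s j + s j) →
                sum (λ j → s j * (2# - δ j)) ≈ sum t
  ∑-*-2-minus s δ t hyp = +-cancelʳ (sum (λ j → s j * δ j)) _ _ (begin
    sum (λ j → s j * (2# - δ j)) + sum (λ j → s j * δ j)  ≈⟨ ∑-distrib-+ (λ j → s j * (2# - δ j)) (λ j → s j * δ j) ⟨
    sum (λ j → s j * (2# - δ j) + s j * δ j)              ≈⟨ sum-cong-≋ (λ j → *-2-minus (s j) (δ j)) ⟩
    sum (λ j → s j + s j)                                 ≈⟨ hyp ⟨
    sum (λ j → s j * δ j + t j)                           ≈⟨ ∑-distrib-+ (λ j → s j * δ j) t ⟩
    sum (λ j → s j * δ j) + sum t                         ≈⟨ +-comm _ _ ⟩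
    sum t + sum (λ j → s j * δ j)                         ∎)
    where
    *-2-minus : ∀ x y → x * (2# - y) + x * y ≈ x + x
    *-2-minus x y = begin
      x * (2# - y) + x * y   ≈⟨ distribˡ x (2# - y) y ⟨
      x * (2# - y + y)       ≈⟨ *-congˡ (+-assoc 2# (- y) y) ⟩
      x * (2# + (- y + y))   ≈⟨ *-congˡ (≈-trans (+-congˡ (-‿inverseˡ y)) (+-identityʳ 2#)) ⟩
      x * 2#                 ≈⟨ distribˡ x 1# 1# ⟩
      x * 1# + x * 1#        ≈⟨ +-cong (*-identityʳ x) (*-identityʳ x) ⟩
      x + x                  ∎

module RootedDistances {c ℓ : Level} (R : CommutativeRing c ℓ) {n : ℕ} (G : SimpleGraph n)
                       (W : WeightedTree.EdgeWeights R G) (T : IsTree G) (r : Fin n) where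
  open CommutativeRing R renaming (refl to ≈-refl; sym to ≈-sym; trans to ≈-trans)
  open WeightedTree R hiding (_≈_)
  open EdgeWeights W
  open SimpleGraph G using (adj) renaming (sym to adj-sym)
  open SemiringSum semiring using (sum; sum-cong-≋; ∑-distrib-+; *-distribˡ-sum)
  open IndicatorSums R
  open Walks G
  open Tree T
  open Rooted r
  open SetoidReasoning setoid

  d : Fin n → Carrier
  d = dist G W T r

  weightFrom : Fin n → List (Fin n) → Carrier
  weightFrom a []       = 0#
  weightFrom a (b ∷ bs) = w a b + weightFrom b bs

  listWeight : List (Fin n) → Carrier
  listWeight []       = 0#
  listWeight (a ∷ as) = weightFrom a as

  weightFrom-vertices : ∀ a {j b} (p : Walk G j b) →
                        weightFrom a (vertices G p) ≡ w a j + walkWeight G W p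
  weightFrom-vertices a (stop j)     = refl
  weightFrom-vertices a (step j e p) = cong (w a j +_) (weightFrom-vertices j p)

  walkWeight≡listWeight : ∀ {a b} (p : Walk G a b) → walkWeight G W p ≡ listWeight (vertices G p)
  walkWeight≡listWeight (stop a)     = refl
  walkWeight≡listWeight (step a e p) = sym (weightFrom-vertices a p)

  weightFrom-∷ʳ : ∀ a xs k j → weightFrom a (xs ∷ʳ k ∷ʳ j) ≈ weightFrom a (xs ∷ʳ k) + w k j
  weightFrom-∷ʳ a []       k j = ≈-trans (+-congˡ (+-identityʳ (w k j))) (+-congʳ (≈-sym (+-identityʳ (w a k))))
  weightFrom-∷ʳ a (x ∷ xs) k j = ≈-trans (+-congˡ (weightFrom-∷ʳ x xs k j)) (≈-sym (+-assoc _ _ _))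

  listWeight-∷ʳ : ∀ xs k j → listWeight (xs ∷ʳ k ∷ʳ j) ≈ listWeight (xs ∷ʳ k) + w k j
  listWeight-∷ʳ []       k j = ≈-trans (+-identityʳ (w k j)) (≈-sym (+-identityˡ (w k j)))
  listWeight-∷ʳ (x ∷ xs) k j = weightFrom-∷ʳ x xs k j

  dist-root : d r ≈ 0#
  dist-root = reflexive (trans (walkWeight≡listWeight (path r)) (cong listWeight pathVertices-root))

  dist-parent : ∀ {j k} → Parent j k → d j ≈ d k + w j k
  dist-parent {j} {k} j→k with vertices-∷ʳ-end (path k)
  ... | ys , eq = begin
    d j                           ≡⟨ walkWeight≡listWeight (path j) ⟩
    listWeight (pathVertices j)   ≡⟨ cong listWeight (trans j→k (cong (_∷ʳ j) eq)) ⟩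
    listWeight (ys ∷ʳ k ∷ʳ j)     ≈⟨ listWeight-∷ʳ ys k j ⟩
    listWeight (ys ∷ʳ k) + w k j  ≡⟨ cong₂ _+_ (sym dist-k) (w-sym k j) ⟩
    d k + w j k                   ∎
    where
    dist-k : d k ≡ listWeight (ys ∷ʳ k)
    dist-k = trans (walkWeight≡listWeight (path k)) (cong listWeight eq)

  isParent : Fin n → Fin n → Bool
  isParent j k = adj j k ∧ does (Parent? j k)

  isParent⇒Parent : ∀ {j k} → isParent j k ≡ true → Parent j k
  isParent⇒Parent {j} {k} e with adj j k
  ... | true = does⇒ (Parent? j k) e

  []·-adj-split : ∀ j k x → [ adj j k ]· x ≈ [ isParent j k ]· x + [ isParent k j ]· x
  []·-adj-split j k x =
    ≈-trans ([]·-split (adj j k) (does (Parent? j k)) (does (Parent? k j)) one-of not-both)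
            (+-congˡ (reflexive (cong (λ b → [ b ∧ does (Parent? k j) ]· x) (adj-sym j k))))
    where
    one-of : adj j k ≡ true → does (Parent? j k) ≡ true ⊎ does (Parent? k j) ≡ true
    one-of e with parent⊎child e
    ... | inj₁ j→k = inj₁ (dec-true (Parent? j k) j→k)
    ... | inj₂ k→j = inj₂ (dec-true (Parent? k j) k→j)
    not-both : does (Parent? j k) ≡ true → does (Parent? k j) ≡ true → ⊥
    not-both p q = ¬parent×child (does⇒ (Parent? j k) p) (does⇒ (Parent? k j) q)

  -- The root has no parent; instead of proving this, the hypothesis makes the summand vanish there.
  ∑-parent : ∀ j {x} → (j ≡ r → x ≈ 0#) → sum (λ k → [ isParent j k ]· x) ≈ x
  ∑-parent j {x} root⇒x≈0 with j ≟ᶠ r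
  ... | yes refl = ≈-trans (sum-zero _ (λ k → []·-zero (isParent r k) (root⇒x≈0 refl)))
                           (≈-sym (root⇒x≈0 refl))
  ... | no j≢r with parent-exists j≢r
  ...   | k , e , j→k = sum-[]·-unique (isParent j) x
                          (cong₂ _∧_ e (dec-true (Parent? j k) j→k))
                          (λ k′ e′ → parent-unique (isParent⇒Parent e′) j→k)

  degree-expansion : ∀ j → (d j * d j) * deg G W j + d j * wdeg G W j ≈
                           sum (λ k → [ adj j k ]· (d j * d j + d j * w j k))
  degree-expansion j = begin
    (d j * d j) * deg G W j + d j * wdeg G W j
      ≈⟨ +-cong (*-distribˡ-sum (d j * d j) (λ k → [ adj j k ]· 1#)) (*-distribˡ-sum (d j) (λ k → [ adj j k ]· w j k)) ⟩
    sum (λ k → (d j * d j) * [ adj j k ]· 1#) + sum (λ k → d j * [ adj j k ]· w j k)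
      ≈⟨ ∑-distrib-+ (λ k → (d j * d j) * [ adj j k ]· 1#) (λ k → d j * [ adj j k ]· w j k) ⟨
    sum (λ k → (d j * d j) * [ adj j k ]· 1# + d j * [ adj j k ]· w j k)
      ≈⟨ sum-cong-≋ (λ k → pointwise (adj j k) (w j k)) ⟩
    sum (λ k → [ adj j k ]· (d j * d j + d j * w j k))
      ∎
    where
    pointwise : ∀ b y → (d j * d j) * [ b ]· 1# + d j * [ b ]· y ≈ [ b ]· (d j * d j + d j * y)
    pointwise true  y = +-congʳ (*-identityʳ _)
    pointwise false y = ≈-trans (+-cong (zeroʳ _) (zeroʳ _)) (+-identityʳ 0#)

  ∑d²deg+d·wdeg≈∑2d² : sum (λ j → (d j * d j) * deg G W j + d j * wdeg G W j) ≈
                       sum (λ j → d j * d j + d j * d j)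
  ∑d²deg+d·wdeg≈∑2d² = begin
    sum (λ j → (d j * d j) * deg G W j + d j * wdeg G W j)
      ≈⟨ sum-cong-≋ degree-expansion ⟩
    sum (λ j → sum (λ k → [ adj j k ]· half j k))
      ≈⟨ ∑∑-orient adj isParent []·-adj-split half ⟩
    sum (λ j → sum (λ k → [ isParent j k ]· (half j k + half k j)))
      ≈⟨ sum-cong-≋ (λ j → sum-cong-≋ (edge-term j)) ⟩
    sum (λ j → sum (λ k → [ isParent j k ]· (d j * d j + d j * d j)))
      ≈⟨ sum-cong-≋ (λ j → ∑-parent j root-term) ⟩
    sum (λ j → d j * d j + d j * d j)
      ∎
    where
    half : Fin n → Fin n → Carrier
    half j k = d j * d j + d j * w j k
    edge-term : ∀ j k → [ isParent j k ]· (half j k + half k j) ≈ [ isParent j k ]· (d j * d j + d j * d j)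
    edge-term j k with isParent j k in e
    ... | false = ≈-refl
    ... | true  = ≈-trans (+-congˡ (+-congˡ (*-congˡ (reflexive (w-sym k j)))))
                          (square-identity (dist-parent (isParent⇒Parent e)))
    root-term : ∀ {j} → j ≡ r → d j * d j + d j * d j ≈ 0#
    root-term refl = ≈-trans (+-cong d²≈0 d²≈0) (+-identityʳ 0#)
      where
      d²≈0 : d r * d r ≈ 0#
      d²≈0 = ≈-trans (*-congʳ dist-root) (zeroˡ (d r))

lemma2p1 : {c ℓ : Level} (R : CommutativeRing c ℓ) → let open WeightedTree R in
           (n : ℕ) (G : SimpleGraph n) (W : EdgeWeights G) (T : IsTree G) →
           ∀ (i : Fin n) → Δmul G W T (τ G W) i ≈ Dmul G W T (wdeg G W) i
lemma2p1 R n G W T i =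
  ∑-*-2-minus (λ j → d j * d j) (deg G W) (λ j → d j * wdeg G W j) ∑d²deg+d·wdeg≈∑2d²
  where
  open CommutativeRing R using (_*_)
  open WeightedTree R using (deg; wdeg)
  open IndicatorSums R using (∑-*-2-minus)
  open RootedDistances R G W T i using (d; ∑d²deg+d·wdeg≈∑2d²)
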